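{- For any numerical semigroup $S$ with multiplicity $m = \mathsf m(S)$, embedding dimension $e = \mathsf e(S)$ and embedding codimension $r = m - e$, the minimal presentation cardinality satisfies $\eta(S) \ge \binom{e}{2} - r$.
   Context: A numerical semigroup is a cofinite subset $S \subseteq \mathbb{Z}_{\ge 0}$ containing $0$ and closed under addition. It has a unique minimal generating set $n_1 < \cdots < n_e$ (its atoms); $\mathsf e(S) = e$ is the embedding dimension and $\mathsf m(S) = n_1$ the multiplicity. The factorization homomorphism $\varphi_S:\mathbb{Z}_{\ge 0}^e \to S$, $z \mapsto z_1n_1 + \cdots + z_en_e$, has kernel the congruence $\ker\varphi_S = \{(z,z') : \varphi_S(z) = \varphi_S(z')\}$. A presentation of $S$ is a subset $\rho \subseteq \ker\varphi_S$ such that the smallest congruence on $\mathbb{Z}_{\ge 0}^e$ containing $\rho$ is $\ker\varphi_S$; it is minimal if no proper subset is a presentation. All minimal presentations have the same cardinality, denoted $\eta(S)$. -}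

module Defs where

open import Data.Nat using (ℕ; zero; suc; _+_; _*_; _≤_; _<_)
open import Data.Fin using (Fin) renaming (_<_ to _<ᶠ_)
open import Data.Vec.Membership.Propositional using (_∈_)
open import Data.Vec using (Vec; lookup) renaming (zipWith to vzipWith)
open import Data.List using (List; length)
import Data.List.Membership.Propositional as LM
open import Data.List.Relation.Unary.Unique.Propositional using (Unique)
open import Data.Product using (_×_; _,_; Σ; ∃)
open import Relation.Binary.PropositionalEquality using (_≡_)
open import Data.Integer using (ℤ; +_; _-_) renaming (_≤_ to _≤ℤ_)
open import Data.Nat.Combinatorics using (_C_)
open import Level using (suc; zero)

Subsetℕ : Set₁
Subsetℕ = ℕ → Set

record IsNumericalSemigroup (S : Subsetℕ) : Set where
  field
    has-zero : S 0
    closed   : ∀ {x y} → S x → S y → S (x + y)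
    cofinite : ∃ λ N → ∀ n → N ≤ n → S n

data Generated (A : Subsetℕ) : ℕ → Set where
  gen-zero : Generated A 0
  gen-add  : ∀ {a s} → A a → Generated A s → Generated A (a + s)

Generates : Subsetℕ → Subsetℕ → Set
Generates A S = (∀ s → S s → Generated A s) × (∀ s → Generated A s → S s)

IsAtoms : (S : Subsetℕ) (e : ℕ) → Vec ℕ e → Set₁
IsAtoms S e a =
  (∀ (i j : Fin e) → i <ᶠ j → lookup a i < lookup a j) ×
  Generates (λ x → x ∈ a) S ×
  (∀ (B : Subsetℕ) → (∀ x → B x → x ∈ a) → Generates B S → ∀ x → x ∈ a → B x)

φ : ∀ {e} → Vec ℕ e → Vec ℕ e → ℕ
φ {zero}  _ _ = 0
φ {suc e} (n Data.Vec.∷ ns) (z Data.Vec.∷ zs) = z * n + φ ns zs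

Pair : ℕ → Set
Pair e = Vec ℕ e × Vec ℕ e

Ker : ∀ {e} → Vec ℕ e → Vec ℕ e → Vec ℕ e → Set
Ker a z z' = φ a z ≡ φ a z'

_⊕_ : ∀ {e} → Vec ℕ e → Vec ℕ e → Vec ℕ e
_⊕_ = vzipWith _+_

data Cong {e} (ρ : Pair e → Set) : Vec ℕ e → Vec ℕ e → Set where
  c-base  : ∀ {x y} → ρ (x , y) → Cong ρ x y
  c-refl  : ∀ {x} → Cong ρ x x
  c-sym   : ∀ {x y} → Cong ρ x y → Cong ρ y x
  c-trans : ∀ {x y z} → Cong ρ x y → Cong ρ y z → Cong ρ x z
  c-add   : ∀ {x y z w} → Cong ρ x y → Cong ρ z w → Cong ρ (x ⊕ z) (y ⊕ w)

IsPresentation : ∀ {e} → Vec ℕ e → (Pair e → Set) → Set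
IsPresentation a ρ =
  (∀ z z' → ρ (z , z') → Ker a z z') ×
  (∀ z z' → Cong ρ z z' → Ker a z z') ×
  (∀ z z' → Ker a z z' → Cong ρ z z')

IsMinimalPresentation : ∀ {e} → Vec ℕ e → List (Pair e) → Set₁
IsMinimalPresentation {e} a ρ =
  IsPresentation a (λ p → p LM.∈ ρ) ×
  (∀ (σ : Pair e → Set) → (∀ p → σ p → p LM.∈ ρ) →
     IsPresentation a σ → ∀ p → p LM.∈ ρ → σ p)

module Submission where

-- Let m = n₁ be the multiplicity and T the C(e,2) factorizations nᵢ + nⱼ (2 ≤ i ≤ j ≤ e) avoiding m.
-- Build a graph on T and the residues modulo m: every other factorization is replaced by the residue
-- of its value, and each relation of a presentation ρ becomes an edge between the images of its two
-- sides.  Since ρ generates ker φ, any two factorizations of one element are then connected.  Add an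
-- edge from each residue not taken by an atom to a φ-least element of T in that class; there are
-- m − e such residues, because the atoms have pairwise distinct residues (a larger atom cannot be a
-- smaller one plus a multiple of m).  Now every z ∈ T reaches its residue: unless φ z is least in a
-- free class (then the added edge applies), φ z = φ w + k m with k > 0 for an atom or a smaller
-- w ∈ T, and w plus k copies of n₁ is a factorization of φ z outside T.  A graph in which each of |T| + m vertices reaches one of m roots has at least |T|
-- edges, so C(e,2) ≤ |ρ| + m − e.

open import Defs
open import Data.Nat using (ℕ; zero; suc; _+_; _*_; _≤_; _<_; z≤n; s≤s; _%_; _/_; NonZero; >-nonZero)
open import Data.Nat.Properties
open import Data.Nat.DivMod using (m≡m%n+[m/n]*n; m%n<n)
open import Data.Nat.Combinatorics using (_C_; nCk+nC[k+1]≡[n+1]C[k+1]; nC1≡n)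
open import Data.Nat.Tactic.RingSolver using (solve-∀)
open import Data.Fin using (Fin; zero; suc)
import Data.Fin.Properties as Fin
open import Data.Vec using (Vec; []; _∷_; head; lookup; replicate; sum)
open import Data.Vec.Properties
  using ( ∷-injectiveˡ; ∷-injectiveʳ; ≡-dec; lookup-zipWith
        ; zipWith-comm; zipWith-assoc; zipWith-identityˡ; zipWith-identityʳ)
open import Data.Vec.Membership.Propositional using (_∈_)
open import Data.Vec.Membership.Propositional.Properties using (∈-lookup)
open import Data.Vec.Relation.Unary.Any using (here; there; index)
open import Data.Vec.Relation.Unary.Any.Properties using (lookup-index)
open import Data.List using (List; []; _∷_; length; map; filter; _++_; allFin; upTo)
open import Data.List.Properties
  using (length-map; length-++; length-tabulate; length-upTo; filter-notAll; filter-all)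
open import Data.List.Membership.Propositional using () renaming (_∈_ to _∈ˡ_; _∉_ to _∉ˡ_)
open import Data.List.Membership.Propositional.Properties
  using (∈-map⁺; ∈-map⁻; ∈-++⁺ˡ; ∈-++⁺ʳ; ∈-++⁻; ∈-filter⁺; ∈-filter⁻; ∈-upTo⁺)
import Data.List.Membership.DecPropositional as DecMembership
open import Data.List.Relation.Binary.Subset.Propositional using (_⊆_)
import Data.List.Relation.Unary.All as All
open import Data.List.Relation.Unary.Any as Any using (here; there)
open import Data.List.Relation.Unary.AllPairs using ([]; _∷_)
open import Data.List.Relation.Unary.Unique.Propositional using (Unique)
import Data.List.Relation.Unary.Unique.Propositional.Properties as Unique
open import Data.List.Extrema.Nat using (argmin; argmin-sel; f[argmin]≤f[⊤]; f[argmin]≤f[xs])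
open import Data.Product using (_×_; _,_; ∃-syntax; proj₁; proj₂) renaming (map to ×-map)
open import Data.Sum using (_⊎_; inj₁; inj₂)
import Data.Sum.Properties as Sum
open import Data.Integer using (ℤ; +_; _-_; +≤+) renaming (_≤_ to _≤ℤ_)
import Data.Integer as ℤ
import Data.Integer.Properties as ℤ
import Data.Integer.Tactic.RingSolver as ℤ
open import Algebra.Properties.CommutativeSemigroup +-commutativeSemigroup
  using () renaming (interchange to +-interchange)
open import Data.Empty using (⊥)
open import Function using (id; _∘_)
open import Relation.Binary.Definitions using (DecidableEquality; tri<; tri≈; tri>)
open import Relation.Binary.PropositionalEquality
open import Relation.Nullary using (¬_; Dec; yes; no; ¬?)
open import Relation.Nullary.Negation using (contradiction)

data Connected {A : Set} (E : List (A × A)) : A → A → Set where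
  conn-refl  : ∀ {x} → Connected E x x
  conn-edge  : ∀ {x y} → (x , y) ∈ˡ E → Connected E x y
  conn-sym   : ∀ {x y} → Connected E x y → Connected E y x
  conn-trans : ∀ {x y z} → Connected E x y → Connected E y z → Connected E x z

module _ {A B : Set} {E : List (A × A)} {F : List (B × B)} where

  Connected-map : (f : A → B) → (∀ {x y} → (x , y) ∈ˡ E → Connected F (f x) (f y)) →
                  ∀ {x y} → Connected E x y → Connected F (f x) (f y)
  Connected-map f edge⇒ conn-refl         = conn-refl
  Connected-map f edge⇒ (conn-edge p)     = edge⇒ p
  Connected-map f edge⇒ (conn-sym c)      = conn-sym (Connected-map f edge⇒ c)
  Connected-map f edge⇒ (conn-trans c d)  = conn-trans (Connected-map f edge⇒ c) (Connected-map f edge⇒ d)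

module _ {A : Set} {E F : List (A × A)} where

  Connected-mono : E ⊆ F → ∀ {x y} → Connected E x y → Connected F x y
  Connected-mono E⊆F = Connected-map id (conn-edge ∘ E⊆F)

≡⇒Connected : ∀ {A : Set} {E : List (A × A)} {x y} → x ≡ y → Connected E x y
≡⇒Connected refl = conn-refl

Connected-[]⇒≡ : ∀ {A : Set} {x y : A} → Connected [] x y → x ≡ y
Connected-[]⇒≡ conn-refl        = refl
Connected-[]⇒≡ (conn-edge ())
Connected-[]⇒≡ (conn-sym c)     = sym (Connected-[]⇒≡ c)
Connected-[]⇒≡ (conn-trans c d) = trans (Connected-[]⇒≡ c) (Connected-[]⇒≡ d)

module Counting {A : Set} (_≟_ : DecidableEquality A) where

  without : A → List A → List A
  without b = filter (λ y → ¬? (b ≟ y))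

  Unique-⊆⇒length≤ : ∀ {xs ys : List A} → Unique xs → xs ⊆ ys → length xs ≤ length ys
  Unique-⊆⇒length≤ {[]}     _              _     = z≤n
  Unique-⊆⇒length≤ {x ∷ xs} {ys} (x∉xs ∷ xs!) xs⊆ys = begin-strict
    length xs              ≤⟨ Unique-⊆⇒length≤ xs! xs⊆ys-x ⟩
    length (without x ys)  <⟨ filter-notAll _ ys (Any.map (λ x≡y x≢y → x≢y x≡y) (xs⊆ys (here refl))) ⟩
    length ys              ∎
    where
    open ≤-Reasoning
    xs⊆ys-x : xs ⊆ without x ys
    xs⊆ys-x v∈xs = ∈-filter⁺ _ (xs⊆ys (there v∈xs)) (All.lookup x∉xs v∈xs)

  length≤1+length-without : ∀ b {xs} → Unique xs → length xs ≤ suc (length (without b xs))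
  length≤1+length-without b {[]}     _ = z≤n
  length≤1+length-without b {x ∷ xs} (x∉xs ∷ xs!) with b ≟ x
  ... | yes refl rewrite filter-all (λ y → ¬? (b ≟ y)) x∉xs = ≤-refl
  ... | no _     = s≤s (length≤1+length-without b xs!)

  contract : A → A → A → A
  contract a b x with b ≟ x
  ... | yes _ = a
  ... | no  _ = x

  contract-≢ : ∀ {a b x} → ¬ b ≡ x → contract a b x ≡ x
  contract-≢ {b = b} {x} b≢x with b ≟ x
  ... | yes b≡x = contradiction b≡x b≢x
  ... | no  _   = refl

  contract-edge : ∀ a b → contract a b a ≡ contract a b b
  contract-edge a b with b ≟ a | b ≟ b
  ... | _     | no b≢b = contradiction refl b≢b
  ... | yes _ | yes _  = refl
  ... | no  _ | yes _  = refl

  Connected-contract : ∀ {a b E x y} → Connected ((a , b) ∷ E) x y →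
    Connected (map (×-map (contract a b) (contract a b)) E) (contract a b x) (contract a b y)
  Connected-contract {a} {b} = Connected-map (contract a b) λ where
    (here refl) → ≡⇒Connected (contract-edge a b)
    (there p)   → conn-edge (∈-map⁺ _ p)

  -- Contracting the edge (a , b) removes the vertex b and one edge.  The index n is only there for
  -- termination: the contracted edge list is a map, not a structural subterm.
  private
    length≤edges+roots′ : ∀ n (E : List (A × A)) → length E ≡ n → {V R : List A} → Unique V →
      (∀ {v} → v ∈ˡ V → ∃[ r ] r ∈ˡ R × Connected E v r) → length V ≤ length E + length R
    length≤edges+roots′ _ [] _ V! V→R =
      Unique-⊆⇒length≤ V! λ v∈V → let r , r∈R , v~r = V→R v∈V in subst (_∈ˡ _) (sym (Connected-[]⇒≡ v~r)) r∈R
    length≤edges+roots′ (suc n) ((a , b) ∷ E) |E|≡1+n {V} {R} V! V→R = begin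
      length V
        ≤⟨ length≤1+length-without b V! ⟩
      suc (length (without b V))
        ≤⟨ s≤s (length≤edges+roots′ n E′ |E′|≡n (Unique.filter⁺ _ V!) V′→R′) ⟩
      suc (length E′ + length (map (contract a b) R))
        ≡⟨ cong suc (cong₂ _+_ (length-map _ E) (length-map _ R)) ⟩
      suc (length E + length R) ∎
      where
      open ≤-Reasoning
      E′ = map (×-map (contract a b) (contract a b)) E
      |E′|≡n : length E′ ≡ n
      |E′|≡n = trans (length-map _ E) (suc-injective |E|≡1+n)
      V′→R′ : ∀ {v} → v ∈ˡ without b V → ∃[ r ] r ∈ˡ map (contract a b) R × Connected E′ v r
      V′→R′ v∈V′ =
        let v∈V , b≢v    = ∈-filter⁻ _ v∈V′
            r , r∈R , v~r = V→R v∈V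
        in contract a b r , ∈-map⁺ _ r∈R ,
           subst (λ w → Connected E′ w (contract a b r)) (contract-≢ b≢v) (Connected-contract v~r)

  length≤edges+roots : ∀ (E : List (A × A)) {V R : List A} → Unique V →
    (∀ {v} → v ∈ˡ V → ∃[ r ] r ∈ˡ R × Connected E v r) → length V ≤ length E + length R
  length≤edges+roots E = length≤edges+roots′ _ E refl

zeros : ∀ {n} → Vec ℕ n
zeros = replicate _ 0

unit : ∀ {n} → Fin n → Vec ℕ n
unit zero    = 1 ∷ zeros
unit (suc i) = 0 ∷ unit i

⊕-comm : ∀ {n} (x y : Vec ℕ n) → x ⊕ y ≡ y ⊕ x
⊕-comm = zipWith-comm +-comm

⊕-assoc : ∀ {n} (x y z : Vec ℕ n) → (x ⊕ y) ⊕ z ≡ x ⊕ (y ⊕ z)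
⊕-assoc = zipWith-assoc +-assoc

⊕-identityʳ : ∀ {n} (x : Vec ℕ n) → x ⊕ zeros ≡ x
⊕-identityʳ = zipWith-identityʳ +-identityʳ

⊕-middle : ∀ {n} (x y z : Vec ℕ n) → x ⊕ (y ⊕ z) ≡ y ⊕ (x ⊕ z)
⊕-middle x y z = begin
  x ⊕ (y ⊕ z)  ≡⟨ ⊕-assoc x y z ⟨
  (x ⊕ y) ⊕ z  ≡⟨ cong (_⊕ z) (⊕-comm x y) ⟩
  (y ⊕ x) ⊕ z  ≡⟨ ⊕-assoc y x z ⟩
  y ⊕ (x ⊕ z)  ∎
  where open ≡-Reasoning

⊕-cancelˡ : ∀ {n} (x : Vec ℕ n) {y z} → x ⊕ y ≡ x ⊕ z → y ≡ z
⊕-cancelˡ []       {[]}     {[]}     _  = refl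
⊕-cancelˡ (x ∷ xs) {y ∷ ys} {z ∷ zs} eq =
  cong₂ _∷_ (+-cancelˡ-≡ x y z (∷-injectiveˡ eq)) (⊕-cancelˡ xs (∷-injectiveʳ eq))

unit-injective : ∀ {n} {i j : Fin n} → unit i ≡ unit j → i ≡ j
unit-injective {i = zero}  {zero}  _  = refl
unit-injective {i = suc i} {suc j} eq = cong suc (unit-injective (∷-injectiveʳ eq))

split-unit : ∀ {n} (v : Vec ℕ n) i → 1 ≤ lookup v i → ∃[ v′ ] v ≡ unit i ⊕ v′
split-unit (suc x ∷ v) zero    _ = x ∷ v , cong (suc x ∷_) (sym (zipWith-identityˡ +-identityˡ v))
split-unit (x ∷ v)     (suc i) p with split-unit v i p
... | v′ , refl = x ∷ v′ , refl

sum-⊕ : ∀ {n} (x y : Vec ℕ n) → sum (x ⊕ y) ≡ sum x + sum y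
sum-⊕ []       []       = refl
sum-⊕ (x ∷ xs) (y ∷ ys) = trans (cong (_+_ (x + y)) (sum-⊕ xs ys)) (+-interchange x y (sum xs) (sum ys))

sum-zeros : ∀ {n} → sum (zeros {n}) ≡ 0
sum-zeros {zero}  = refl
sum-zeros {suc n} = sum-zeros {n}

sum-unit : ∀ {n} (i : Fin n) → sum (unit i) ≡ 1
sum-unit {suc n} zero = cong suc (sum-zeros {n})
sum-unit (suc i)      = sum-unit i

sum≡0⇒zeros : ∀ {n} (v : Vec ℕ n) → sum v ≡ 0 → v ≡ zeros
sum≡0⇒zeros []           _  = refl
sum≡0⇒zeros (zero ∷ v)   eq = cong (0 ∷_) (sum≡0⇒zeros v eq)

sum≤1⇒zeros⊎unit : ∀ {n} (v : Vec ℕ n) → sum v ≤ 1 → v ≡ zeros ⊎ ∃[ i ] v ≡ unit i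
sum≤1⇒zeros⊎unit []             _         = inj₁ refl
sum≤1⇒zeros⊎unit (1 ∷ v)        (s≤s v≤0) = inj₂ (zero , cong (1 ∷_) (sum≡0⇒zeros v (n≤0⇒n≡0 v≤0)))
sum≤1⇒zeros⊎unit (zero ∷ v)     v≤1 with sum≤1⇒zeros⊎unit v v≤1
... | inj₁ refl       = inj₁ refl
... | inj₂ (i , refl) = inj₂ (suc i , refl)
sum≤1⇒zeros⊎unit (suc (suc _) ∷ _) (s≤s ())

φ-⊕ : ∀ {n} (a x y : Vec ℕ n) → φ a (x ⊕ y) ≡ φ a x + φ a y
φ-⊕ []       []       []       = refl
φ-⊕ (n ∷ ns) (x ∷ xs) (y ∷ ys) = begin
  (x + y) * n + φ ns (xs ⊕ ys)           ≡⟨ cong₂ _+_ (*-distribʳ-+ n x y) (φ-⊕ ns xs ys) ⟩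
  (x * n + y * n) + (φ ns xs + φ ns ys)  ≡⟨ +-interchange (x * n) (y * n) (φ ns xs) (φ ns ys) ⟩
  (x * n + φ ns xs) + (y * n + φ ns ys)  ∎
  where open ≡-Reasoning

φ-zeros : ∀ {n} (a : Vec ℕ n) → φ a zeros ≡ 0
φ-zeros []      = refl
φ-zeros (_ ∷ a) = φ-zeros a

φ-unit : ∀ {n} (a : Vec ℕ n) i → φ a (unit i) ≡ lookup a i
φ-unit (x ∷ a) zero    = trans (cong (_+_ (1 * x)) (φ-zeros a)) (trans (+-identityʳ (1 * x)) (*-identityˡ x))
φ-unit (x ∷ a) (suc i) = φ-unit a i

φ≡0⇒zeros : ∀ {n} (a : Vec ℕ n) → (∀ i → 0 < lookup a i) → ∀ v → φ a v ≡ 0 → v ≡ zeros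
φ≡0⇒zeros []      _   []          _  = refl
φ≡0⇒zeros (x ∷ a) a>0 (zero ∷ v)  eq = cong (0 ∷_) (φ≡0⇒zeros a (a>0 ∘ suc) v eq)
φ≡0⇒zeros (x ∷ a) a>0 (suc z ∷ v) eq =
  contradiction (m+n≡0⇒m≡0 x (m+n≡0⇒m≡0 (x + z * x) eq)) (n>0⇒n≢0 (a>0 zero))

Generated-+ : ∀ {B : Subsetℕ} {x y} → Generated B x → Generated B y → Generated B (x + y)
Generated-+ gen-zero gy = gy
Generated-+ {B} {y = y} (gen-add {b} {s} b∈B gs) gy =
  subst (Generated B) (sym (+-assoc b s y)) (gen-add b∈B (Generated-+ gs gy))

Generated-mono : ∀ {B B′ : Subsetℕ} → (∀ x → B x → B′ x) → ∀ {s} → Generated B s → Generated B′ s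
Generated-mono B⊆B′ gen-zero          = gen-zero
Generated-mono B⊆B′ (gen-add b∈B gs)  = gen-add (B⊆B′ _ b∈B) (Generated-mono B⊆B′ gs)

Generated-φ : ∀ {n} {B : Subsetℕ} (a v : Vec ℕ n) → (∀ k → 1 ≤ lookup v k → B (lookup a k)) →
              Generated B (φ a v)
Generated-φ []      []      _       = gen-zero
Generated-φ {B = B} (x ∷ a) (z ∷ v) support⊆B =
  Generated-+ (copies z (support⊆B zero)) (Generated-φ a v (support⊆B ∘ suc))
  where
  copies : ∀ z → (1 ≤ z → B x) → Generated B (z * x)
  copies zero    _   = gen-zero
  copies (suc z) x∈B = gen-add (x∈B (s≤s z≤n)) (copies z (λ _ → x∈B (s≤s z≤n)))

module Atoms {S : Subsetℕ} {e : ℕ} {a : Vec ℕ e} (atoms : IsAtoms S e a) where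

  private
    increasing = proj₁ atoms
    generates  = proj₁ (proj₂ atoms)
    minimal    = proj₂ (proj₂ atoms)

  lookup-injective : ∀ {i j} → lookup a i ≡ lookup a j → i ≡ j
  lookup-injective {i} {j} eq with Fin.<-cmp i j
  ... | tri< i<j _ _ = contradiction eq (<⇒≢ (increasing i j i<j))
  ... | tri≈ _ i≡j _ = i≡j
  ... | tri> _ _ j<i = contradiction (sym eq) (<⇒≢ (increasing j i j<i))

  all-atoms-needed : (B : Subsetℕ) → (∀ x → B x → x ∈ a) →
                     (∀ {s} → Generated (_∈ a) s → Generated B s) → ∀ x → x ∈ a → B x
  all-atoms-needed B B⊆a regenerate = minimal B B⊆a
    ((λ s s∈S → regenerate (proj₁ generates s s∈S)) , (λ s gs → proj₂ generates s (Generated-mono B⊆a gs)))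

  atom-positive : ∀ i → 0 < lookup a i
  atom-positive i with lookup a i | all-atoms-needed B (λ _ → proj₁) drop-zeros (lookup a i) (∈-lookup i a)
    where
    B : Subsetℕ
    B x = x ∈ a × x ≢ 0
    drop-zeros : ∀ {s} → Generated (_∈ a) s → Generated B s
    drop-zeros gen-zero                     = gen-zero
    drop-zeros (gen-add {zero}  _   gs)     = drop-zeros gs
    drop-zeros (gen-add {suc x} x∈a gs)     = gen-add (x∈a , λ ()) (drop-zeros gs)
  ... | zero  | _ , 0≢0 = contradiction refl 0≢0
  ... | suc _ | _       = s≤s z≤n

  -- If a factorization v of the atom nᵢ avoided nᵢ, the other atoms would already generate S.
  atom-factorization : ∀ v i → φ a v ≡ lookup a i → v ≡ unit i
  atom-factorization v i φv≡aᵢ with lookup v i in vᵢ≡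
  ... | suc _ with split-unit v i (subst (1 ≤_) (sym vᵢ≡) (s≤s z≤n))
  ...   | v′ , refl = trans (cong (unit i ⊕_) v′≡0) (⊕-identityʳ (unit i))
    where
    φv′≡0 : φ a v′ ≡ 0
    φv′≡0 = +-cancelˡ-≡ (lookup a i) _ _ (begin
      lookup a i + φ a v′          ≡⟨ cong (_+ φ a v′) (φ-unit a i) ⟨
      φ a (unit i) + φ a v′        ≡⟨ φ-⊕ a (unit i) v′ ⟨
      φ a (unit i ⊕ v′)            ≡⟨ φv≡aᵢ ⟩
      lookup a i                   ≡⟨ +-identityʳ (lookup a i) ⟨
      lookup a i + 0               ∎)
      where open ≡-Reasoning
    v′≡0 : v′ ≡ zeros
    v′≡0 = φ≡0⇒zeros a atom-positive v′ φv′≡0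
  atom-factorization v i φv≡aᵢ | zero =
    contradiction refl (proj₂ (all-atoms-needed B (λ _ → proj₁) replace-aᵢ (lookup a i) (∈-lookup i a)))
    where
    B : Subsetℕ
    B x = x ∈ a × x ≢ lookup a i
    aᵢ-from-others : Generated B (lookup a i)
    aᵢ-from-others = subst (Generated B) φv≡aᵢ (Generated-φ a v λ k vₖ≥1 →
      ∈-lookup k a , λ aₖ≡aᵢ → contradiction (subst (λ j → 1 ≤ lookup v j) (lookup-injective aₖ≡aᵢ) vₖ≥1)
                                              (subst (λ x → ¬ 1 ≤ x) (sym vᵢ≡) λ ()))
    replace-aᵢ : ∀ {s} → Generated (_∈ a) s → Generated B s
    replace-aᵢ gen-zero = gen-zero
    replace-aᵢ (gen-add {x} x∈a gs) with x ≟ lookup a i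
    ... | yes refl = Generated-+ aᵢ-from-others (replace-aᵢ gs)
    ... | no  x≢aᵢ = gen-add (x∈a , x≢aᵢ) (replace-aᵢ gs)

  sum-atom-factorization : ∀ v i → φ a v ≡ lookup a i → sum v ≡ 1
  sum-atom-factorization v i φv≡aᵢ = trans (cong sum (atom-factorization v i φv≡aᵢ)) (sum-unit i)

  short-factorization-unique : ∀ u v → sum u ≤ 1 → φ a v ≡ φ a u → v ≡ u
  short-factorization-unique u v |u|≤1 φv≡φu with sum≤1⇒zeros⊎unit u |u|≤1
  ... | inj₁ refl       = φ≡0⇒zeros a atom-positive v (trans φv≡φu (φ-zeros a))
  ... | inj₂ (i , refl) = atom-factorization v i (trans φv≡φu (φ-unit a i))

pairs-with-first : ∀ n → List (Vec ℕ (suc n))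
pairs-with-first n = map (λ j → unit zero ⊕ unit j) (allFin (suc n))

pairs : ∀ n → List (Vec ℕ n)
pairs zero    = []
pairs (suc n) = pairs-with-first n ++ map (0 ∷_) (pairs n)

length-pairs : ∀ n → length (pairs n) ≡ suc n C 2
length-pairs zero    = refl
length-pairs (suc n) = begin
  length (pairs-with-first n ++ map (0 ∷_) (pairs n))
    ≡⟨ length-++ (pairs-with-first n) ⟩
  length (pairs-with-first n) + length (map (0 ∷_) (pairs n))
    ≡⟨ cong₂ _+_ (trans (length-map _ (allFin (suc n))) (length-tabulate id))
                 (trans (length-map _ (pairs n)) (length-pairs n)) ⟩
  suc n + suc n C 2
    ≡⟨ cong (_+ suc n C 2) (nC1≡n (suc n)) ⟨
  suc n C 1 + suc n C 2
    ≡⟨ nCk+nC[k+1]≡[n+1]C[k+1] (suc n) 1 ⟩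
  suc (suc n) C 2 ∎
  where open ≡-Reasoning

pairs-unique : ∀ n → Unique (pairs n)
pairs-unique zero    = []
pairs-unique (suc n) = Unique.++⁺
  (Unique.map⁺ (unit-injective ∘ ⊕-cancelˡ (unit zero)) (Unique.allFin⁺ (suc n)))
  (Unique.map⁺ ∷-injectiveʳ (pairs-unique n))
  λ (p , q) → heads-differ (∈-map⁻ _ p) (∈-map⁻ _ q)
  where
  heads-differ : ∀ {z : Vec ℕ (suc n)} →
    ∃[ j ] j ∈ˡ allFin (suc n) × z ≡ unit zero ⊕ unit j → ∃[ w ] w ∈ˡ pairs n × z ≡ 0 ∷ w → ⊥
  heads-differ (j , _ , refl) (_ , _ , eq) =
    1+n≢0 (trans (sym (lookup-zipWith _+_ zero (unit zero) (unit j))) (cong (λ v → lookup v zero) eq))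

sum-unit⊕unit : ∀ {n} (i j : Fin n) → sum (unit i ⊕ unit j) ≡ 2
sum-unit⊕unit i j = trans (sum-⊕ (unit i) (unit j)) (cong₂ _+_ (sum-unit i) (sum-unit j))

sum-pairs : ∀ n {z} → z ∈ˡ pairs n → sum z ≡ 2
sum-pairs (suc n) z∈ with ∈-++⁻ (pairs-with-first n) z∈
... | inj₁ z∈first = let j , _ , z≡ = ∈-map⁻ _ {xs = allFin (suc n)} z∈first
                     in trans (cong sum z≡) (sum-unit⊕unit zero j)
... | inj₂ z∈rest  = let w , w∈ , z≡ = ∈-map⁻ (0 ∷_) z∈rest
                     in trans (cong sum z≡) (sum-pairs n w∈)

%-≡∧<⇒≡+[1+k]*n : ∀ {x y n} .{{_ : NonZero n}} → x % n ≡ y % n → x < y → ∃[ k ] y ≡ x + suc k * n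
%-≡∧<⇒≡+[1+k]*n {x} {y} {n} x%n≡y%n x<y = k , (begin
  y                              ≡⟨ m≡m%n+[m/n]*n y n ⟩
  y % n + y / n * n              ≡⟨ cong₂ (λ r q → r + q * n) (sym x%n≡y%n) (sym qy≡) ⟩
  x % n + (suc (x / n) + k) * n  ≡⟨ regroup (x % n) (x / n) k n ⟩
  x % n + x / n * n + suc k * n  ≡⟨ cong (_+ suc k * n) (m≡m%n+[m/n]*n x n) ⟨
  x + suc k * n                  ∎)
  where
  open ≡-Reasoning
  regroup : ∀ r q k n → r + (suc q + k) * n ≡ r + q * n + suc k * n
  regroup = solve-∀
  qx<qy : x / n < y / n
  qx<qy = *-cancelʳ-< n (x / n) (y / n) (+-cancelˡ-< (x % n) _ _ (subst₂ _<_
    (m≡m%n+[m/n]*n x n) (trans (m≡m%n+[m/n]*n y n) (cong (_+ y / n * n) (sym x%n≡y%n))) x<y))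
  k = proj₁ (m≤n⇒∃[o]m+o≡n qx<qy)
  qy≡ = proj₂ (m≤n⇒∃[o]m+o≡n qx<qy)

module PairGraph {S : Subsetℕ} {e m : ℕ} {ns : Vec ℕ e} (atoms : IsAtoms S (suc e) (m ∷ ns))
                 (ρ : List (Pair (suc e))) (presentation : IsPresentation (m ∷ ns) (_∈ˡ ρ)) where

  open Atoms atoms

  instance
    m-nonZero : NonZero m
    m-nonZero = >-nonZero (atom-positive zero)

  Factorization : Set
  Factorization = Vec ℕ (suc e)

  a : Factorization
  a = m ∷ ns

  T : List Factorization
  T = map (0 ∷_) (pairs e)

  _∈T? : ∀ z → Dec (z ∈ˡ T)
  z ∈T? = DecMembership._∈?_ (≡-dec _≟_) z T

  Vertex : Set
  Vertex = ℕ ⊎ Factorization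

  vertex : Factorization → Vertex
  vertex z with z ∈T?
  ... | yes _ = inj₂ z
  ... | no  _ = inj₁ (φ a z % m)

  vertex-∈T : ∀ {z} → z ∈ˡ T → vertex z ≡ inj₂ z
  vertex-∈T {z} z∈T with z ∈T?
  ... | yes _   = refl
  ... | no z∉T  = contradiction z∈T z∉T

  vertex-∉T : ∀ {z} → z ∉ˡ T → vertex z ≡ inj₁ (φ a z % m)
  vertex-∉T {z} z∉T with z ∈T?
  ... | yes z∈T = contradiction z∈T z∉T
  ... | no  _   = refl

  sum-T : ∀ {z} → z ∈ˡ T → sum z ≡ 2
  sum-T z∈T = let w , w∈ , z≡ = ∈-map⁻ (0 ∷_) z∈T in trans (cong sum z≡) (sum-pairs e w∈)

  head-T : ∀ {z} → z ∈ˡ T → head z ≡ 0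
  head-T z∈T = let w , _ , z≡ = ∈-map⁻ (0 ∷_) z∈T in cong head z≡

  summand-of-T : ∀ {u t} → (u ⊕ t) ∈ˡ T → 1 ≤ sum t → sum u ≤ 1
  summand-of-T {u} {t} ut∈T t≥1 = +-cancelʳ-≤ 1 (sum u) 1 (begin
    sum u + 1      ≤⟨ +-monoʳ-≤ (sum u) t≥1 ⟩
    sum u + sum t  ≡⟨ sum-⊕ u t ⟨
    sum (u ⊕ t)    ≡⟨ sum-T ut∈T ⟩
    2              ∎)
    where open ≤-Reasoning

  -- If u ⊕ t ∈ T with t ≠ 0, then u has length ≤ 1 and is therefore the only factorization of its value.
  vertex-translate : ∀ {u v t} → φ a u ≡ φ a v → 1 ≤ sum t → vertex (u ⊕ t) ≡ vertex (v ⊕ t)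
  vertex-translate {u} {v} {t} φu≡φv t≥1 = by-cases ((u ⊕ t) ∈T?) ((v ⊕ t) ∈T?)
    where
    by-cases : Dec ((u ⊕ t) ∈ˡ T) → Dec ((v ⊕ t) ∈ˡ T) → vertex (u ⊕ t) ≡ vertex (v ⊕ t)
    by-cases (yes ut∈T) _ =
      cong (λ w → vertex (w ⊕ t)) (sym (short-factorization-unique u v (summand-of-T ut∈T t≥1) (sym φu≡φv)))
    by-cases (no _) (yes vt∈T) =
      cong (λ w → vertex (w ⊕ t)) (short-factorization-unique v u (summand-of-T vt∈T t≥1) φu≡φv)
    by-cases (no ut∉T) (no vt∉T) = begin
      vertex (u ⊕ t)          ≡⟨ vertex-∉T ut∉T ⟩
      inj₁ (φ a (u ⊕ t) % m)  ≡⟨ cong (λ x → inj₁ (x % m)) φut≡φvt ⟩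
      inj₁ (φ a (v ⊕ t) % m)  ≡⟨ vertex-∉T vt∉T ⟨
      vertex (v ⊕ t)          ∎
      where
      open ≡-Reasoning
      φut≡φvt : φ a (u ⊕ t) ≡ φ a (v ⊕ t)
      φut≡φvt = trans (φ-⊕ a u t) (trans (cong (_+ φ a t) φu≡φv) (sym (φ-⊕ a v t)))

  ρ-edges : List (Vertex × Vertex)
  ρ-edges = map (×-map vertex vertex) ρ

  relation-translate-connected : ∀ {u v} → (u , v) ∈ˡ ρ → ∀ t →
                                 Connected ρ-edges (vertex (u ⊕ t)) (vertex (v ⊕ t))
  relation-translate-connected {u} {v} uv∈ρ t with sum t in |t|≡
  ... | zero rewrite sum≡0⇒zeros t |t|≡ | ⊕-identityʳ u | ⊕-identityʳ v = conn-edge (∈-map⁺ _ uv∈ρ)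
  ... | suc _ =
    ≡⇒Connected (vertex-translate (proj₁ presentation u v uv∈ρ) (subst (1 ≤_) (sym |t|≡) (s≤s z≤n)))

  congruence-connected : ∀ {x y} → Cong (_∈ˡ ρ) x y → ∀ t →
                         Connected ρ-edges (vertex (x ⊕ t)) (vertex (y ⊕ t))
  congruence-connected (c-base uv∈ρ)     t = relation-translate-connected uv∈ρ t
  congruence-connected c-refl            t = conn-refl
  congruence-connected (c-sym x~y)       t = conn-sym (congruence-connected x~y t)
  congruence-connected (c-trans x~y y~z) t =
    conn-trans (congruence-connected x~y t) (congruence-connected y~z t)
  congruence-connected (c-add {x} {y} {z} {w} x~y z~w) t =
    conn-trans (≡⇒Connected (cong vertex (⊕-assoc x z t)))
    (conn-trans (congruence-connected x~y (z ⊕ t))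
    (conn-trans (≡⇒Connected (cong vertex (⊕-middle y z t)))
    (conn-trans (congruence-connected z~w (y ⊕ t))
                (≡⇒Connected (cong vertex (trans (⊕-middle w y t) (sym (⊕-assoc y w t))))))))

  kernel-connected : ∀ {x y} → φ a x ≡ φ a y → Connected ρ-edges (vertex x) (vertex y)
  kernel-connected {x} {y} φx≡φy =
    subst₂ (λ x′ y′ → Connected ρ-edges (vertex x′) (vertex y′)) (⊕-identityʳ x) (⊕-identityʳ y)
      (congruence-connected (proj₂ (proj₂ presentation) x y φx≡φy) zeros)

  raise : ℕ → Factorization → Factorization
  raise t (z₀ ∷ z) = t + z₀ ∷ z

  φ-raise : ∀ t z → φ a (raise t z) ≡ φ a z + t * m
  φ-raise t (z₀ ∷ z) = regroup t z₀ m (φ ns z)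
    where
    regroup : ∀ t z₀ m r → (t + z₀) * m + r ≡ z₀ * m + r + t * m
    regroup = solve-∀

  sum-raise : ∀ t z → sum (raise t z) ≡ t + sum z
  sum-raise t (z₀ ∷ z) = +-assoc t z₀ (sum z)

  raise-∉T : ∀ t z → raise (suc t) z ∉ˡ T
  raise-∉T t (z₀ ∷ z) z∈T with head-T z∈T
  ... | ()

  atom≢above : ∀ w t k → 1 ≤ sum w → φ a w + suc t * m ≢ lookup a k
  atom≢above w t k w≥1 φw+[1+t]m≡aₖ = n>0⇒n≢0 w≥1 (m+n≡0⇒n≡0 t (suc-injective (begin
    suc t + sum w          ≡⟨ sum-raise (suc t) w ⟨
    sum (raise (suc t) w)  ≡⟨ sum-atom-factorization (raise (suc t) w) k φz≡aₖ ⟩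
    1                      ∎)))
    where
    open ≡-Reasoning
    φz≡aₖ : φ a (raise (suc t) w) ≡ lookup a k
    φz≡aₖ = trans (φ-raise (suc t) w) φw+[1+t]m≡aₖ

  -- Adding copies of m to w gives a factorization of the same value as X that lies outside T.
  connected-to-residue-if-above : ∀ {X} → X ∈ˡ T → ∀ w t → φ a X ≡ φ a w + suc t * m →
                                  Connected ρ-edges (inj₂ X) (inj₁ (φ a X % m))
  connected-to-residue-if-above {X} X∈T w t φX≡ =
    subst₂ (Connected ρ-edges) (vertex-∈T X∈T)
      (trans (vertex-∉T (raise-∉T t w)) (cong (λ x → inj₁ (x % m)) φz≡φX))
      (kernel-connected (sym φz≡φX))
    where
    φz≡φX : φ a (raise (suc t) w) ≡ φ a X
    φz≡φX = trans (φ-raise (suc t) w) (sym φX≡)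

  atom-residue : Fin (suc e) → ℕ
  atom-residue k = lookup a k % m

  atom-residue-≢ : ∀ k l → lookup a k < lookup a l → atom-residue k ≢ atom-residue l
  atom-residue-≢ k l aₖ<aₗ rₖ≡rₗ =
    let t , aₗ≡ = %-≡∧<⇒≡+[1+k]*n rₖ≡rₗ aₖ<aₗ
    in atom≢above (unit k) t l (≤-reflexive (sym (sum-unit k)))
         (trans (cong (_+ suc t * m) (φ-unit a k)) (sym aₗ≡))

  atom-residue-injective : ∀ {k l} → atom-residue k ≡ atom-residue l → k ≡ l
  atom-residue-injective {k} {l} rₖ≡rₗ with <-cmp (lookup a k) (lookup a l)
  ... | tri< aₖ<aₗ _ _ = contradiction rₖ≡rₗ (atom-residue-≢ k l aₖ<aₗ)
  ... | tri≈ _ aₖ≡aₗ _ = lookup-injective aₖ≡aₗ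
  ... | tri> _ _ aₗ<aₖ = contradiction (sym rₖ≡rₗ) (atom-residue-≢ l k aₗ<aₖ)

  atom-residues : List ℕ
  atom-residues = map atom-residue (allFin (suc e))

  free-residues : List ℕ
  free-residues = filter (λ c → ¬? (DecMembership._∈?_ _≟_ c atom-residues)) (upTo m)

  pairs-in-class : ℕ → List Factorization
  pairs-in-class c = filter (λ z → φ a z % m ≟ c) T

  lowest : ℕ → List Factorization → Vertex
  lowest c []       = inj₁ c
  lowest c (z ∷ zs) = inj₂ (argmin (φ a) z zs)

  lowest-≤ : ∀ c {zs X} → X ∈ˡ zs → ∃[ x ] lowest c zs ≡ inj₂ x × x ∈ˡ zs × φ a x ≤ φ a X
  lowest-≤ c {z ∷ zs} X∈ = argmin (φ a) z zs , refl , argmin∈ , argmin≤ X∈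
    where
    argmin∈ : argmin (φ a) z zs ∈ˡ z ∷ zs
    argmin∈ with argmin-sel (φ a) z zs
    ... | inj₁ ≡z  = here ≡z
    ... | inj₂ ∈zs = there ∈zs
    argmin≤ : ∀ {X} → X ∈ˡ z ∷ zs → φ a (argmin (φ a) z zs) ≤ φ a X
    argmin≤ (here refl) = f[argmin]≤f[⊤] {f = φ a} z zs
    argmin≤ (there X∈zs) = All.lookup (f[argmin]≤f[xs] {f = φ a} z zs) X∈zs

  residue-edges : List (Vertex × Vertex)
  residue-edges = map (λ c → inj₁ c , lowest c (pairs-in-class c)) free-residues

  edges : List (Vertex × Vertex)
  edges = ρ-edges ++ residue-edges

  T-connected-to-atom-residue : ∀ {X} k → X ∈ˡ T → φ a X % m ≡ atom-residue k →
                                Connected ρ-edges (inj₂ X) (inj₁ (φ a X % m))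
  T-connected-to-atom-residue {X} k X∈T rX≡rₖ with <-cmp (φ a X) (lookup a k)
  ... | tri≈ _ φX≡aₖ _ = contradiction (trans (sym (sum-T X∈T)) (sum-atom-factorization X k φX≡aₖ)) λ ()
  ... | tri< φX<aₖ _ _ =
    let t , aₖ≡ = %-≡∧<⇒≡+[1+k]*n rX≡rₖ φX<aₖ
    in contradiction (sym aₖ≡) (atom≢above X t k (subst (1 ≤_) (sym (sum-T X∈T)) (s≤s z≤n)))
  ... | tri> _ _ aₖ<φX =
    let t , φX≡ = %-≡∧<⇒≡+[1+k]*n (sym rX≡rₖ) aₖ<φX
    in connected-to-residue-if-above X∈T (unit k) t (trans φX≡ (cong (_+ suc t * m) (sym (φ-unit a k))))

  T-connected-to-free-residue : ∀ {X} → X ∈ˡ T → φ a X % m ∈ˡ free-residues →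
                                Connected edges (inj₂ X) (inj₁ (φ a X % m))
  T-connected-to-free-residue {X} X∈T c∈free with lowest-≤ (φ a X % m) (∈-filter⁺ _ X∈T refl)
  ... | x , lowest≡x , x∈class , φx≤φX with ∈-filter⁻ (λ z → φ a z % m ≟ φ a X % m) {xs = T} x∈class
  ...   | x∈T , rx≡rX with m≤n⇒m<n∨m≡n φx≤φX
  ...     | inj₁ φx<φX =
    let t , φX≡ = %-≡∧<⇒≡+[1+k]*n rx≡rX φx<φX
    in Connected-mono ∈-++⁺ˡ (connected-to-residue-if-above X∈T x t φX≡)
  ...     | inj₂ φx≡φX =
    conn-trans (Connected-mono ∈-++⁺ˡ X~x) (conn-sym (conn-edge (∈-++⁺ʳ ρ-edges edge∈)))
    where
    X~x : Connected ρ-edges (inj₂ X) (inj₂ x)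
    X~x = subst₂ (Connected ρ-edges) (vertex-∈T X∈T) (vertex-∈T x∈T) (kernel-connected (sym φx≡φX))
    edge∈ : (inj₁ (φ a X % m) , inj₂ x) ∈ˡ residue-edges
    edge∈ = subst (λ v → (inj₁ (φ a X % m) , v) ∈ˡ residue-edges) lowest≡x (∈-map⁺ _ c∈free)

  T-connected-to-residue : ∀ {X} → X ∈ˡ T → Connected edges (inj₂ X) (inj₁ (φ a X % m))
  T-connected-to-residue {X} X∈T with DecMembership._∈?_ _≟_ (φ a X % m) atom-residues
  ... | yes r∈atoms = let k , _ , rX≡rₖ = ∈-map⁻ atom-residue {xs = allFin (suc e)} r∈atoms
                      in Connected-mono ∈-++⁺ˡ (T-connected-to-atom-residue k X∈T rX≡rₖ)
  ... | no  r∉atoms = T-connected-to-free-residue X∈T (∈-filter⁺ _ (∈-upTo⁺ (m%n<n (φ a X) m)) r∉atoms)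

  vertices : List Vertex
  vertices = map inj₂ T ++ map inj₁ (upTo m)

  residues : List Vertex
  residues = map inj₁ (upTo m)

  vertices-unique : Unique vertices
  vertices-unique = Unique.++⁺
    (Unique.map⁺ Sum.inj₂-injective (Unique.map⁺ ∷-injectiveʳ (pairs-unique e)))
    (Unique.map⁺ Sum.inj₁-injective (Unique.upTo⁺ m))
    λ (p , q) → sides-differ (∈-map⁻ inj₂ {xs = T} p) (∈-map⁻ inj₁ {xs = upTo m} q)
    where
    sides-differ : ∀ {v} → ∃[ X ] X ∈ˡ T × v ≡ inj₂ X → ∃[ c ] c ∈ˡ upTo m × v ≡ inj₁ c → ⊥
    sides-differ (_ , _ , refl) (_ , _ , ())

  vertex-reaches-residue : ∀ {v} → v ∈ˡ vertices → ∃[ r ] r ∈ˡ residues × Connected edges v r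
  vertex-reaches-residue {v} v∈ with ∈-++⁻ (map inj₂ T) v∈
  ... | inj₁ v∈T with ∈-map⁻ inj₂ {xs = T} v∈T
  ...   | X , X∈T , refl =
    inj₁ (φ a X % m) , ∈-map⁺ inj₁ (∈-upTo⁺ (m%n<n (φ a X) m)) , T-connected-to-residue X∈T
  vertex-reaches-residue {v} v∈ | inj₂ v∈residues = v , v∈residues , conn-refl

  length-T≤ : length T ≤ length ρ + length free-residues
  length-T≤ = +-cancelʳ-≤ m (length T) (length ρ + length free-residues) (begin
    length T + m                             ≡⟨ |vertices| ⟨
    length vertices                          ≤⟨ length≤edges+roots edges vertices-unique vertex-reaches-residue ⟩
    length edges + length residues           ≡⟨ |edges|+|residues| ⟩
    length ρ + length free-residues + m      ∎)
    where
    open ≤-Reasoning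
    open Counting (Sum.≡-dec _≟_ (≡-dec _≟_)) using (length≤edges+roots)
    |upTo| : length (map inj₁ (upTo m)) ≡ m
    |upTo| = trans (length-map inj₁ (upTo m)) (length-upTo m)
    |vertices| : length vertices ≡ length T + m
    |vertices| = trans (length-++ (map inj₂ T)) (cong₂ _+_ (length-map inj₂ T) |upTo|)
    |edges|+|residues| : length edges + length residues ≡ length ρ + length free-residues + m
    |edges|+|residues| = cong₂ _+_
      (trans (length-++ ρ-edges) (cong₂ _+_ (length-map _ ρ) (length-map _ free-residues))) |upTo|

  free-residues-bound : length free-residues + suc e ≤ m
  free-residues-bound =
    subst₂ _≤_ |free++atoms| (length-upTo m) (Unique-⊆⇒length≤ free++atoms-unique ⊆upTo)
    where
    open Counting _≟_ using (Unique-⊆⇒length≤)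
    ∈atoms? = DecMembership._∈?_ _≟_
    free++atoms-unique : Unique (free-residues ++ atom-residues)
    free++atoms-unique = Unique.++⁺
      (Unique.filter⁺ _ (Unique.upTo⁺ m))
      (Unique.map⁺ atom-residue-injective (Unique.allFin⁺ (suc e)))
      λ (r∈free , r∈atoms) →
        proj₂ (∈-filter⁻ (λ c → ¬? (∈atoms? c atom-residues)) {xs = upTo m} r∈free) r∈atoms
    ⊆upTo : free-residues ++ atom-residues ⊆ upTo m
    ⊆upTo r∈ with ∈-++⁻ free-residues r∈
    ... | inj₁ r∈free  = proj₁ (∈-filter⁻ (λ c → ¬? (∈atoms? c atom-residues)) {xs = upTo m} r∈free)
    ... | inj₂ r∈atoms with ∈-map⁻ atom-residue {xs = allFin (suc e)} r∈atoms
    ...   | k , _ , refl = ∈-upTo⁺ (m%n<n (lookup a k) m)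
    |free++atoms| : length (free-residues ++ atom-residues) ≡ length free-residues + suc e
    |free++atoms| = trans (length-++ free-residues)
      (cong (_+_ (length free-residues))
        (trans (length-map atom-residue (allFin (suc e))) (length-tabulate id)))

  [1+e]C2+[1+e]≤|ρ|+m : suc e C 2 + suc e ≤ length ρ + m
  [1+e]C2+[1+e]≤|ρ|+m = begin
    suc e C 2 + suc e                         ≡⟨ cong (_+ suc e) |T| ⟨
    length T + suc e                          ≤⟨ +-monoˡ-≤ (suc e) length-T≤ ⟩
    length ρ + length free-residues + suc e   ≡⟨ +-assoc (length ρ) (length free-residues) (suc e) ⟩
    length ρ + (length free-residues + suc e) ≤⟨ +-monoʳ-≤ (length ρ) free-residues-bound ⟩
    length ρ + m                              ∎
    where
    open ≤-Reasoning
    |T| : length T ≡ suc e C 2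
    |T| = trans (length-map (0 ∷_) (pairs e)) (length-pairs e)

multiplicity≡head : ∀ {S e n m} {ns : Vec ℕ e} → IsAtoms S (suc e) (n ∷ ns) →
                    m ∈ n ∷ ns → (∀ x → x ∈ n ∷ ns → m ≤ x) → m ≡ n
multiplicity≡head _     (here m≡n)   _       = m≡n
multiplicity≡head atoms (there m∈ns) m≤atoms =
  contradiction (m≤atoms _ (here refl))
    (<⇒≱ (subst (_ <_) (sym (lookup-index m∈ns)) (proj₁ atoms zero (suc (index m∈ns)) (s≤s z≤n))))

c+e≤l+m⇒c-[m-e]≤l : ∀ c e m l → c + e ≤ l + m → (+ c) - ((+ m) - (+ e)) ≤ℤ + l
c+e≤l+m⇒c-[m-e]≤l c e m l c+e≤l+m = subst₂ _≤ℤ_ lhs rhs (ℤ.+-monoˡ-≤ (ℤ.- (+ m)) (+≤+ c+e≤l+m))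
  where
  move : ∀ (x y z : ℤ) → x ℤ.+ z - y ≡ x - (y - z)
  move = ℤ.solve-∀
  cancel : ∀ (x y : ℤ) → x ℤ.+ y - y ≡ x
  cancel = ℤ.solve-∀
  lhs : + (c + e) - + m ≡ (+ c) - ((+ m) - (+ e))
  lhs = trans (cong (_- + m) (ℤ.pos-+ c e)) (move (+ c) (+ m) (+ e))
  rhs : + (l + m) - + m ≡ + l
  rhs = trans (cong (_- + m) (ℤ.pos-+ l m)) (cancel (+ l) (+ m))

theorem3p4 : (S : ℕ → Set) → IsNumericalSemigroup S →
    (e : ℕ) (a : Vec ℕ e) → IsAtoms S e a →
    (m : ℕ) → m ∈ a → (∀ x → x ∈ a → m ≤ x) →
    (ρ : List (Pair e)) → Unique ρ → IsMinimalPresentation a ρ →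
    ((+ (e C 2)) - ((+ m) - (+ e))) ≤ℤ (+ (length ρ))
theorem3p4 S _ zero    []       _     m ()  _       ρ _ _
theorem3p4 S _ (suc e) (n ∷ ns) atoms m m∈a m≤atoms ρ _ (presentation , _)
  with refl ← multiplicity≡head atoms m∈a m≤atoms =
  c+e≤l+m⇒c-[m-e]≤l (suc e C 2) (suc e) m (length ρ) (PairGraph.[1+e]C2+[1+e]≤|ρ|+m atoms ρ presentation)
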